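{- Let $u \in \{0,1\}^{\mathbb N}$ be a Sturmian sequence. Then $u$ belongs to the set $$\Gamma := \{u \in \{0,1\}^{\mathbb N} : \forall k \geq 0,\ \overline{u} \leq S^k u \leq u\}$$ if and only if there exists a characteristic Sturmian sequence $v \in \{0,1\}^{\mathbb N}$ such that $v$ begins with the letter $1$ and $u = 1v$.
   Context: Binary sequences are written $u = (u_n)_{n \geq 0}$ with $u_n \in \{0,1\}$. The shift $S$ maps $(u_n)_{n\geq 0}$ to $(u_{n+1})_{n \geq 0}$, and $S^k$ is its $k$-th iterate (with $S^0 u = u$). The sequence $\overline{u}$ is defined by $\overline{u}_n := 1 - u_n$. For a letter $a \in \{0,1\}$, $av$ denotes the sequence $a v_0 v_1 v_2 \cdots$. The order $\leq$ on binary sequences is the lexicographic order induced by $0<1$. A binary sequence is Sturmian if for every $n \geq 0$ it has exactly $n+1$ distinct factors (blocks of consecutive letters) of length $n$; equivalently it is not eventually periodic and is balanced. A characteristic Sturmian sequence is a sequence of the form $c_\alpha = (\lfloor (n+2)\alpha \rfloor - \lfloor (n+1)\alpha \rfloor)_{n \geq 0}$ for some irrational $\alpha \in (0,1)$; equivalently, a binary sequence $v$ that is not periodic and satisfies $0v \leq S^k v \leq 1v$ for all $k \geq 0$. -}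

module Defs where

open import Data.Bool using (Bool; true; false; not)
open import Data.Nat using (ℕ; zero; suc; _+_; _<_; _≤_)
open import Data.Fin using (Fin; toℕ)
open import Data.Vec using (Vec; tabulate)
open import Data.List using (List; length)
open import Data.List.Relation.Unary.Unique.Propositional using (Unique)
open import Data.List.Membership.Propositional using (_∈_)
open import Data.Product using (Σ; ∃; ∃-syntax; _×_; _,_)
open import Data.Sum using (_⊎_)
open import Relation.Nullary using (¬_)
open import Relation.Binary.PropositionalEquality using (_≡_)

-- Letters: false = 0, true = 1.
Seq : Set
Seq = ℕ → Bool

S^ : ℕ → Seq → Seq
S^ k u n = u (k + n)

compl : Seq → Seq
compl u n = not (u n)

_∷ₛ_ : Bool → Seq → Seq
(a ∷ₛ v) zero = a
(a ∷ₛ v) (suc n) = v n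

_≤lex_ : Seq → Seq → Set
u ≤lex v = (∀ n → u n ≡ v n)
         ⊎ (∃[ n ] ((∀ i → i < n → u i ≡ v i) × u n ≡ false × v n ≡ true))

factor : Seq → (n i : ℕ) → Vec Bool n
factor u n i = tabulate (λ j → u (i + toℕ j))

IsFactor : Seq → {n : ℕ} → Vec Bool n → Set
IsFactor u {n} w = ∃[ i ] (factor u n i ≡ w)

HasFactorCount : Seq → (n m : ℕ) → Set
HasFactorCount u n m =
  Σ (List (Vec Bool n)) λ ws →
    Unique ws × length ws ≡ m
    × (∀ i → factor u n i ∈ ws)
    × (∀ {w} → w ∈ ws → IsFactor u w)

Sturmian : Seq → Set
Sturmian u = ∀ n → HasFactorCount u n (suc n)

Periodic : Seq → Set
Periodic v = ∃[ p ] (1 ≤ p × (∀ n → v (p + n) ≡ v n))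

-- characteristic Sturmian sequence (combinatorial characterization from the context)
CharacteristicSturmian : Seq → Set
CharacteristicSturmian v =
  ¬ Periodic v × (∀ k → ((false ∷ₛ v) ≤lex S^ k v) × (S^ k v ≤lex (true ∷ₛ v)))

Γ : Seq → Set
Γ u = ∀ k → (compl u ≤lex S^ k u) × (S^ k u ≤lex u)

-- Γ forces u to begin with 11 (after 10 it would forbid both 00 and 11, so u would alternate), and
-- then u = 1v with every S^k v ≤ 1v.  The other bound 0v ≤ S^k v can only fail at a first mismatch
-- of 1 against 0, which exhibits a prefix 1w1 of u together with a factor 0w0.  A Sturmian sequence
-- has no such pair: counting factors shows that it is aperiodic and has at most one right special
-- factor of each length.  Reading u in blocks (10 ↦ 1, 0 ↦ 0 when 11 does not occur; 10 ↦ 1, 1 ↦ 0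
-- followed by complementation when 00 does not occur) preserves both properties and turns the pair
-- 1w1, 0w0 into one with a shorter w, so induction on |w| excludes it.  Conversely, the bounds on
-- the shifts of a characteristic v give the bounds defining Γ after comparing at most two letters.

module Submission where

open import Defs
open import Data.Bool using (Bool; true; false; not; _∧_)
import Data.Bool.Properties as Bool
open import Data.Empty using (⊥-elim)
open import Data.Fin using (toℕ; fromℕ<)
open import Data.Fin.Properties using (toℕ<n; toℕ-fromℕ<)
open import Data.List using (List; []; _∷_; map; length; upTo)
open import Data.List.Membership.Propositional using (_∈_; _∉_)
open import Data.List.Membership.Propositional.Properties using (∈-map⁺; ∈-map⁻; ∈-upTo⁺)
open import Data.List.Properties using (length-map; length-upTo)
open import Data.List.Relation.Unary.Any using (here; there)
import Data.List.Relation.Unary.All as All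
import Data.List.Relation.Unary.All.Properties as All
open import Data.List.Relation.Unary.AllPairs as AllPairs using ([]; _∷_)
import Data.List.Relation.Unary.AllPairs.Properties as AllPairs
open import Data.List.Relation.Unary.Unique.Propositional using (Unique)
open import Data.Nat using (ℕ; zero; suc; _+_; _⊔_; _∸_; _≤_; _<_; z≤n; s≤s; _<?_)
open import Data.Nat.Induction using (<-rec)
open import Data.Nat.Properties
open import Algebra.Properties.CommutativeSemigroup +-commutativeSemigroup
  using (xy∙z≈y∙xz; x∙yz≈yx∙z)
open import Data.Product using (∃-syntax; _×_; _,_; proj₁; proj₂)
open import Data.Sum using (_⊎_; inj₁; inj₂)
open import Data.Vec using (Vec; lookup)
import Data.Vec.Properties as Vec
open import Function using (_∘′_; _∘_)
open import Function.Bundles using (_⇔_; mk⇔)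
open import Relation.Binary using (tri<; tri≈; tri>)
open import Relation.Binary.PropositionalEquality
open import Relation.Nullary using (¬_; yes; no)
open import Relation.Nullary.Decidable using (¬¬-excluded-middle)

-- Agreement of segments

Agree : Seq → ℕ → ℕ → ℕ → Set
Agree u a b n = ∀ t → t < n → u (a + t) ≡ u (b + t)

Agree-sym : ∀ {u a b n} → Agree u a b n → Agree u b a n
Agree-sym agree t t<n = sym (agree t t<n)

Agree-≤ : ∀ {u a b m n} → m ≤ n → Agree u a b n → Agree u a b m
Agree-≤ m≤n agree t t<m = agree t (<-≤-trans t<m m≤n)

Agree-drop : ∀ {u} a b e {n} → Agree u a b (e + n) → Agree u (a + e) (b + e) n
Agree-drop {u} a b e agree t t<n = begin
  u (a + e + t)   ≡⟨ cong u (+-assoc a e t) ⟩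
  u (a + (e + t)) ≡⟨ agree (e + t) (+-monoʳ-< e t<n) ⟩
  u (b + (e + t)) ≡⟨ cong u (+-assoc b e t) ⟨
  u (b + e + t)   ∎
  where open ≡-Reasoning

Agree-head : ∀ {u} a b {n} → Agree u a b (suc n) → u a ≡ u b
Agree-head {u} a b agree =
  trans (cong u (sym (+-identityʳ a))) (trans (agree 0 (s≤s z≤n)) (cong u (+-identityʳ b)))

Agree-compl : ∀ {u} a b {n} → Agree u a b n → Agree (compl u) a b n
Agree-compl a b agree t t<n = cong not (agree t t<n)

Agree-cons : ∀ {u a b n} → u a ≡ u b → Agree u (suc a) (suc b) n → Agree u a b (suc n)
Agree-cons {u} {a} {b} first _    zero    _         =
  trans (cong u (+-identityʳ a)) (trans first (cong u (sym (+-identityʳ b))))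
Agree-cons {u} {a} {b} _     rest (suc t) (s≤s t<n) =
  trans (cong u (+-suc a t)) (trans (rest t t<n) (cong u (sym (+-suc b t))))

Agree-snoc : ∀ {u a b n} → Agree u a b n → u (a + n) ≡ u (b + n) → Agree u a b (suc n)
Agree-snoc agree last t t<1+n with m<1+n⇒m<n∨m≡n t<1+n
... | inj₁ t<n  = agree t t<n
... | inj₂ refl = last

Agree-++ : ∀ {u} a b m {n} → Agree u a b m → Agree u (a + m) (b + m) n → Agree u a b (m + n)
Agree-++ {u} a b m agree₁ agree₂ t t<m+n with t <? m
... | yes t<m = agree₁ t t<m
... | no t≮m with m≤n⇒∃[o]m+o≡n (≮⇒≥ t≮m)
...   | e , refl = begin
  u (a + (m + e)) ≡⟨ cong u (+-assoc a m e) ⟨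
  u (a + m + e)   ≡⟨ agree₂ e (+-cancelˡ-< m e _ t<m+n) ⟩
  u (b + m + e)   ≡⟨ cong u (+-assoc b m e) ⟩
  u (b + (m + e)) ∎
  where open ≡-Reasoning

agreeOrMismatch : ∀ {u} a b B → Agree u a b B ⊎ ∃[ d ] Agree u a b d × u (a + d) ≢ u (b + d)
agreeOrMismatch         a b zero    = inj₁ λ _ ()
agreeOrMismatch {u} a b (suc B) with agreeOrMismatch {u} a b B
... | inj₂ mismatch = inj₂ mismatch
... | inj₁ agree with u (a + B) Bool.≟ u (b + B)
...   | yes same = inj₁ (Agree-snoc {u} {a} {b} agree same)
...   | no  diff = inj₂ (B , agree , diff)

factor-≡⇒Agree : ∀ {u n a b} → factor u n a ≡ factor u n b → Agree u a b n
factor-≡⇒Agree {u} {n} {a} {b} eq t t<n = begin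
  u (a + t)                                ≡⟨ letterOf a ⟨
  lookup (factor u n a) (fromℕ< t<n)        ≡⟨ cong (λ w → lookup w (fromℕ< t<n)) eq ⟩
  lookup (factor u n b) (fromℕ< t<n)        ≡⟨ letterOf b ⟩
  u (b + t)                                ∎
  where
  open ≡-Reasoning
  letterOf : ∀ c → lookup (factor u n c) (fromℕ< t<n) ≡ u (c + t)
  letterOf c = trans (Vec.lookup∘tabulate _ (fromℕ< t<n)) (cong (λ s → u (c + s)) (toℕ-fromℕ< t<n))

Agree⇒factor-≡ : ∀ {u n a b} → Agree u a b n → factor u n a ≡ factor u n b
Agree⇒factor-≡ agree = Vec.tabulate-cong (λ j → agree (toℕ j) (toℕ<n j))

factor-suc-≡⇒factor-≡ : ∀ {u n a b} → factor u (suc n) a ≡ factor u (suc n) b →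
                        factor u n a ≡ factor u n b
factor-suc-≡⇒factor-≡ {u} {n} {a} {b} eq =
  Agree⇒factor-≡ {u} (Agree-≤ {u} {a} {b} (n≤1+n n) (factor-≡⇒Agree {u} eq))

-- Counting factors

module _ {A : Set} where

  private
    remove : ∀ {x : A} ys → x ∈ ys → List A
    remove (_ ∷ ys) (here _)   = ys
    remove (y ∷ ys) (there x∈) = y ∷ remove ys x∈

    length-remove : ∀ {x : A} ys (x∈ : x ∈ ys) → suc (length (remove ys x∈)) ≡ length ys
    length-remove (_ ∷ _)  (here _)   = refl
    length-remove (_ ∷ ys) (there x∈) = cong suc (length-remove ys x∈)

    ∈-remove : ∀ {x z : A} ys (x∈ : x ∈ ys) → z ∈ ys → x ≢ z → z ∈ remove ys x∈
    ∈-remove (_ ∷ _)  (here refl) (here refl) x≢z = ⊥-elim (x≢z refl)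
    ∈-remove (_ ∷ _)  (here _)    (there z∈)  _   = z∈
    ∈-remove (_ ∷ _)  (there _)   (here z≡)   _   = here z≡
    ∈-remove (_ ∷ ys) (there x∈)  (there z∈)  x≢z = there (∈-remove ys x∈ z∈ x≢z)

  Unique-⊆⇒length-≤ : ∀ {xs ys : List A} → Unique xs → (∀ {x} → x ∈ xs → x ∈ ys) →
                       length xs ≤ length ys
  Unique-⊆⇒length-≤ {[]}     _            _  = z≤n
  Unique-⊆⇒length-≤ {x ∷ xs} {ys} (x∉ ∷ unique) xs⊆ys = begin
    suc (length xs)                      ≤⟨ s≤s (Unique-⊆⇒length-≤ unique xs⊆rest) ⟩
    suc (length (remove ys (xs⊆ys (here refl)))) ≡⟨ length-remove ys _ ⟩
    length ys                            ∎
    where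
    open ≤-Reasoning
    xs⊆rest : ∀ {z} → z ∈ xs → z ∈ remove ys (xs⊆ys (here refl))
    xs⊆rest z∈ = ∈-remove ys _ (xs⊆ys (there z∈)) (All.lookup x∉ z∈)

  valuesBelow-≤ : ∀ (f : ℕ → A) m {xs : List A} → Unique xs →
                  (∀ {x} → x ∈ xs → ∃[ j ] j < m × f j ≡ x) → length xs ≤ m
  valuesBelow-≤ f m {xs} unique below = begin
    length xs               ≤⟨ Unique-⊆⇒length-≤ unique xs⊆ ⟩
    length (map f (upTo m)) ≡⟨ trans (length-map f (upTo m)) (length-upTo m) ⟩
    m                       ∎
    where
    open ≤-Reasoning
    xs⊆ : ∀ {x} → x ∈ xs → x ∈ map f (upTo m)
    xs⊆ x∈ with below x∈
    ... | j , j<m , refl = ∈-map⁺ f (∈-upTo⁺ j<m)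

  Unique-map-injectiveOn : ∀ {B : Set} (g : A → B) {xs a b} → Unique (map g xs) →
                           a ∈ xs → b ∈ xs → g a ≡ g b → a ≡ b
  Unique-map-injectiveOn g (_ ∷ _)      (here refl) (here refl) _  = refl
  Unique-map-injectiveOn g (ga∉ ∷ _)    (here refl) (there b∈)  eq =
    ⊥-elim (All.lookup ga∉ (∈-map⁺ g b∈) eq)
  Unique-map-injectiveOn g (gb∉ ∷ _)    (there a∈)  (here refl) eq =
    ⊥-elim (All.lookup gb∉ (∈-map⁺ g a∈) (sym eq))
  Unique-map-injectiveOn g (_ ∷ unique) (there a∈)  (there b∈)  eq =
    Unique-map-injectiveOn g unique a∈ b∈ eq

  Unique-map-coarser : ∀ {B C : Set} (f : A → B) (g : A → C) {xs} →
                       (∀ {a b} → f a ≡ f b → g a ≡ g b) → Unique (map g xs) → Unique (map f xs)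
  Unique-map-coarser f g f≡⇒g≡ =
    AllPairs.map⁺ ∘′ AllPairs.map (λ g≢ f≡ → g≢ (f≡⇒g≡ f≡)) ∘′ AllPairs.map⁻

module _ {A : Set} (f : ℕ → A) {p start bound : ℕ} (1≤p : 1 ≤ p)
         (periodic : ∀ j → start ≤ j → p + j ≤ bound → f (p + j) ≡ f j) where

  valueRecursBelow : ∀ i → i ≤ bound → ∃[ j ] j < start + p × f j ≡ f i
  valueRecursBelow = <-rec _ step
    where
    step : ∀ i → (∀ {i'} → i' < i → i' ≤ bound → ∃[ j ] j < start + p × f j ≡ f i') →
           i ≤ bound → ∃[ j ] j < start + p × f j ≡ f i
    step i rec i≤bound with i <? start + p
    ... | yes i< = i , i< , refl
    ... | no i≮ = reduce (i ∸ p) p+j≡i (m+n≤o⇒m≤o∸n start (≮⇒≥ i≮))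
                         (subst (_≤ bound) (sym p+j≡i) i≤bound)
      where
      p+j≡i : p + (i ∸ p) ≡ i
      p+j≡i = m+[n∸m]≡n (≤-trans (m≤n+m p start) (≮⇒≥ i≮))
      reduce : ∀ j → p + j ≡ i → start ≤ j → p + j ≤ bound →
               ∃[ k ] k < start + p × f k ≡ f i
      reduce j p+j≡i start≤j p+j≤bound
        with rec (subst (j <_) p+j≡i (m<n+m j 1≤p)) (≤-trans (m≤n+m j p) p+j≤bound)
      ... | k , k< , fk≡fj = k , k< , (begin
        f k       ≡⟨ fk≡fj ⟩
        f j       ≡⟨ periodic j start≤j p+j≤bound ⟨
        f (p + j) ≡⟨ cong f p+j≡i ⟩
        f i       ∎)
        where open ≡-Reasoning

RightSpecial : Seq → ℕ → ℕ → Set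
RightSpecial u i n = ∃[ j ] ∃[ k ] Agree u j i n × u (j + n) ≡ false ×
                                   Agree u k i n × u (k + n) ≡ true

UniqueRightSpecial : Seq → Set
UniqueRightSpecial u = ∀ n i i' → RightSpecial u i n → RightSpecial u i' n → Agree u i i' n

EventuallyPeriodic : Seq → ℕ → ℕ → Set
EventuallyPeriodic u p N = ∀ i → N ≤ i → u (p + i) ≡ u i

Aperiodic : Seq → Set
Aperiodic u = ∀ p N → 1 ≤ p → ¬ EventuallyPeriodic u p N

RightSpecial-suffix : ∀ {u} p e L → RightSpecial u p (e + L) → RightSpecial u (p + e) L
RightSpecial-suffix {u} p e L (j , k , agreeʲ , endʲ , agreeᵏ , endᵏ) =
  j + e , k + e , Agree-drop {u} j p e agreeʲ , trans (cong u (+-assoc j e L)) endʲ ,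
                  Agree-drop {u} k p e agreeᵏ , trans (cong u (+-assoc k e L)) endᵏ

module _ {u : Seq} {n : ℕ} where

  occurrenceBound : (ws : List (Vec Bool n)) → (∀ {w} → w ∈ ws → IsFactor u w) →
                    ∃[ I ] ∀ {w} → w ∈ ws → ∃[ i ] i ≤ I × factor u n i ≡ w
  occurrenceBound []       _      = 0 , λ ()
  occurrenceBound (w ∷ ws) occurs with occurs (here refl) | occurrenceBound ws (occurs ∘′ there)
  ... | i , refl | I , bounded = i ⊔ I , λ where
    (here refl) → i , m≤m⊔n i I , refl
    (there w∈)  → let j , j≤I , eq = bounded w∈ in j , ≤-trans j≤I (m≤n⊔m i I) , eq

  occurrencePositions : (ws : List (Vec Bool n)) → (∀ {w} → w ∈ ws → IsFactor u w) →
                        ∃[ ps ] map (factor u n) ps ≡ ws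
  occurrencePositions []       _      = [] , refl
  occurrencePositions (w ∷ ws) occurs with occurs (here refl) | occurrencePositions ws (occurs ∘′ there)
  ... | i , refl | ps , refl = i ∷ ps , refl

-- Of the two extensions of a right special factor, at most one is the extension at its listed occurrence.
module _ {u : Seq} {n : ℕ} {ps : List ℕ} (unique : Unique (map (factor u n) ps))
         (complete : ∀ i → factor u n i ∈ map (factor u n) ps) where

  freshExtension : ∀ {i} → RightSpecial u i n →
    ∃[ x ] factor u n x ≡ factor u n i × factor u (suc n) x ∉ map (factor u (suc n)) ps
  freshExtension {i} (j , k , agreeʲ , endʲ , agreeᵏ , endᵏ) with ∈-map⁻ (factor u n) (complete i)
  ... | p , p∈ , fi≡fp with otherExtension (u (p + n))
    where
    otherExtension : ∀ b → ∃[ x ] Agree u x i n × u (x + n) ≢ b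
    otherExtension true  = j , agreeʲ , Bool.not-¬ endʲ
    otherExtension false = k , agreeᵏ , Bool.not-¬ endᵏ
  ... | x , agree , x≢p = x , Agree⇒factor-≡ {u} agree , fresh
    where
    fresh : factor u (suc n) x ∉ map (factor u (suc n)) ps
    fresh fx∈ with ∈-map⁻ (factor u (suc n)) fx∈
    ... | q , q∈ , fx≡fq with Unique-map-injectiveOn (factor u n) unique q∈ p∈
          (trans (sym (factor-suc-≡⇒factor-≡ {u} fx≡fq)) (trans (Agree⇒factor-≡ {u} agree) fi≡fp))
    ...   | refl = x≢p (factor-≡⇒Agree {u} fx≡fq n ≤-refl)

module _ {u : Seq} (sturmian : Sturmian u) where

  -- Otherwise all s + p + 1 factors of length s + p would already occur before position s + p.
  suffixesDiverge : ∀ s p → 1 ≤ p → ∃[ B ] ¬ Agree u s (s + p) B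
  suffixesDiverge s p 1≤p with sturmian (s + p)
  ... | ws , unique , length≡ , _ , occurs with occurrenceBound {u} ws occurs
  ...   | I , bounded = I + n , λ agree →
    <-irrefl refl (subst (_≤ n) length≡ (valuesBelow-≤ (factor u n) n unique (recurBelow agree)))
    where
    n = s + p
    recurBelow : Agree u s (s + p) (I + n) → ∀ {w} → w ∈ ws → ∃[ j ] j < n × factor u n j ≡ w
    recurBelow agree w∈ with bounded w∈
    ... | i , i≤I , refl = valueRecursBelow (factor u n) 1≤p periodic i i≤I
      where
      periodic : ∀ j → s ≤ j → p + j ≤ I → factor u n (p + j) ≡ factor u n j
      periodic j s≤j p+j≤I with m≤n⇒∃[o]m+o≡n s≤j
      ... | e , refl = Agree⇒factor-≡ {u} λ t t<n → begin
        u (p + (s + e) + t) ≡⟨ cong (λ x → u (x + t)) (x∙yz≈yx∙z p s e) ⟩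
        u (s + p + e + t)   ≡⟨ cong u (+-assoc (s + p) e t) ⟩
        u (s + p + (e + t)) ≡⟨ agree (e + t) (+-mono-≤-< (≤-trans (m≤n+m e (p + s)) e≤) t<n) ⟨
        u (s + (e + t))     ≡⟨ cong u (+-assoc s e t) ⟨
        u (s + e + t)       ∎
        where
        open ≡-Reasoning
        e≤ : p + s + e ≤ I
        e≤ = ≤-trans (≤-reflexive (+-assoc p s e)) p+j≤I

  Sturmian⇒Aperiodic : Aperiodic u
  Sturmian⇒Aperiodic p N 1≤p periodic with suffixesDiverge N p 1≤p
  ... | _ , diverge = diverge λ t _ → begin
    u (N + t)       ≡⟨ periodic (N + t) (m≤m+n N t) ⟨
    u (p + (N + t)) ≡⟨ cong u (xy∙z≈y∙xz N p t) ⟨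
    u (N + p + t)   ∎
    where open ≡-Reasoning

  -- Two distinct right special factors of length n would yield n + 3 factors of length n + 1.
  private
    rightSpecialsEqual : ∀ {n i₁ i₂} → RightSpecial u i₁ n → RightSpecial u i₂ n →
                         factor u n i₁ ≡ factor u n i₂
    rightSpecialsEqual {n} {i₁} {i₂} rs₁ rs₂ with sturmian n | sturmian (suc n)
    ... | ws , unique , length≡ , complete , occurs | ws′ , _ , length≡′ , complete′ , _
      with occurrencePositions {u} ws occurs
    ... | ps , refl with Vec.≡-dec Bool._≟_ (factor u n i₁) (factor u n i₂)
    ...   | yes f₁≡f₂ = f₁≡f₂
    ...   | no  f₁≢f₂
      with freshExtension {u} unique complete rs₁ | freshExtension {u} unique complete rs₂
    ...     | x₁ , fx₁≡ , x₁∉ | x₂ , fx₂≡ , x₂∉ =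
      ⊥-elim (<-irrefl refl (subst₂ _≤_ lengthE length≡′ (Unique-⊆⇒length-≤ uniqueE E⊆ws′)))
      where
      E₀ = map (factor u (suc n)) ps
      E  = factor u (suc n) x₁ ∷ factor u (suc n) x₂ ∷ E₀

      uniqueE : Unique E
      uniqueE = (x₁≢x₂ All.∷ All.¬Any⇒All¬ E₀ x₁∉) ∷ All.¬Any⇒All¬ E₀ x₂∉ ∷
                Unique-map-coarser (factor u (suc n)) (factor u n) (factor-suc-≡⇒factor-≡ {u} {n}) unique
        where
        x₁≢x₂ : factor u (suc n) x₁ ≢ factor u (suc n) x₂
        x₁≢x₂ eq = f₁≢f₂ (trans (sym fx₁≡) (trans (factor-suc-≡⇒factor-≡ {u} eq) fx₂≡))

      E⊆ws′ : ∀ {w} → w ∈ E → w ∈ ws′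
      E⊆ws′ (here refl)         = complete′ x₁
      E⊆ws′ (there (here refl)) = complete′ x₂
      E⊆ws′ (there (there w∈)) with ∈-map⁻ (factor u (suc n)) w∈
      ... | q , _ , refl = complete′ q

      lengthE : length E ≡ suc (suc (suc n))
      lengthE = cong (suc ∘′ suc)
        (trans (length-map (factor u (suc n)) ps) (trans (sym (length-map (factor u n) ps)) length≡))

  Sturmian⇒UniqueRightSpecial : UniqueRightSpecial u
  Sturmian⇒UniqueRightSpecial n i₁ i₂ rs₁ rs₂ = factor-≡⇒Agree {u} (rightSpecialsEqual rs₁ rs₂)

-- Reading a sequence in blocks

isTen : Seq → ℕ → Bool
isTen u p = u p ∧ not (u (suc p))

blockLength : Bool → ℕ
blockLength true  = 2
blockLength false = 1

-- u is cut greedily into blocks 10 and single letters; derived u k records whether block k is 10.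
blockStart : Seq → ℕ → ℕ
blockStart u zero    = 0
blockStart u (suc k) = blockStart u k + blockLength (isTen u (blockStart u k))

derived : Seq → Seq
derived u k = isTen u (blockStart u k)

blocksLength : Seq → ℕ → ℕ → ℕ
blocksLength u i zero    = 0
blocksLength u i (suc n) = blocksLength u i n + blockLength (derived u (i + n))

data Offset (b : Bool) : ℕ → Set where
  head : Offset b 0
  tail : b ≡ true → Offset b 1

offset : ∀ b {r} → r < blockLength b → Offset b r
offset _     {zero}        _                 = head
offset true  {suc zero}    _                 = tail refl
offset true  {suc (suc _)} (s≤s (s≤s ()))
offset false {suc _}       (s≤s ())

1≤blockLength : ∀ b → 1 ≤ blockLength b
1≤blockLength true  = s≤s z≤n
1≤blockLength false = s≤s z≤n

isTen-head : ∀ {u p} → isTen u p ≡ true → u p ≡ true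
isTen-head {u} {p} eq with u p
... | true = refl

isTen-tail : ∀ {u p} → isTen u p ≡ true → u (suc p) ≡ false
isTen-tail {u} {p} eq with u p | u (suc p)
... | true | false = refl

isTen-cong : ∀ {u p q} → u p ≡ u q → (u p ≡ true → u (suc p) ≡ u (suc q)) →
             isTen u p ≡ isTen u q
isTen-cong {u} {p} {q} head≡ tail≡ with u p | u q | head≡
... | false | false | _ = refl
... | true  | true  | _ = cong not (tail≡ refl)

module Blocks (u : Seq) where

  blockStart-+ : ∀ i n → blockStart u (i + n) ≡ blockStart u i + blocksLength u i n
  blockStart-+ i zero    = trans (cong (blockStart u) (+-identityʳ i)) (sym (+-identityʳ _))
  blockStart-+ i (suc n) = begin
    blockStart u (i + suc n)                   ≡⟨ cong (blockStart u) (+-suc i n) ⟩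
    blockStart u (i + n) + ℓ                   ≡⟨ cong (_+ ℓ) (blockStart-+ i n) ⟩
    blockStart u i + blocksLength u i n + ℓ    ≡⟨ +-assoc (blockStart u i) _ ℓ ⟩
    blockStart u i + blocksLength u i (suc n)  ∎
    where
    open ≡-Reasoning
    ℓ = blockLength (derived u (i + n))

  blocksLength-≥ : ∀ i n → n ≤ blocksLength u i n
  blocksLength-≥ i zero    = z≤n
  blocksLength-≥ i (suc n) = subst (_≤ blocksLength u i (suc n)) (+-comm n 1)
    (+-mono-≤ (blocksLength-≥ i n) (1≤blockLength (derived u (i + n))))

  blocksLength-mono : ∀ i {s n} → s ≤ n → blocksLength u i s ≤ blocksLength u i n
  blocksLength-mono i {s} s≤n with m≤n⇒∃[o]m+o≡n s≤n
  ... | d , refl = go d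
    where
    go : ∀ d → blocksLength u i s ≤ blocksLength u i (s + d)
    go zero    = ≤-reflexive (cong (blocksLength u i) (sym (+-identityʳ s)))
    go (suc d) = ≤-trans (≤-trans (go d) (m≤m+n _ _))
                         (≤-reflexive (cong (blocksLength u i) (sym (+-suc s d))))

  blocksLength-< : ∀ i {s n} → s < n → blocksLength u i s < blocksLength u i n
  blocksLength-< i {s} s<n =
    <-≤-trans (m<m+n _ (1≤blockLength (derived u (i + s)))) (blocksLength-mono i s<n)

  blockStart-≥ : ∀ k → k ≤ blockStart u k
  blockStart-≥ k = subst (k ≤_) (sym (blockStart-+ 0 k)) (blocksLength-≥ 0 k)

  blockStart-< : ∀ {a b} → a < b → blockStart u a < blockStart u b
  blockStart-< {a} a<b with m≤n⇒∃[o]m+o≡n a<b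
  ... | d , refl = begin-strict
    blockStart u a                            <⟨ m<m+n _ (s≤s z≤n) ⟩
    blockStart u a + suc d                    ≤⟨ +-monoʳ-≤ _ (blocksLength-≥ a (suc d)) ⟩
    blockStart u a + blocksLength u a (suc d) ≡⟨ blockStart-+ a (suc d) ⟨
    blockStart u (a + suc d)                  ≡⟨ cong (blockStart u) (+-suc a d) ⟩
    blockStart u (suc a + d)                  ∎
    where open ≤-Reasoning

  blockStart-injective : ∀ {a b} → blockStart u a ≡ blockStart u b → a ≡ b
  blockStart-injective {a} {b} eq with <-cmp a b
  ... | tri< a<b _ _ = ⊥-elim (<-irrefl eq (blockStart-< a<b))
  ... | tri≈ _ a≡b _ = a≡b
  ... | tri> _ _ b<a = ⊥-elim (<-irrefl (sym eq) (blockStart-< b<a))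

  blockStart-suc : ∀ k {b} → derived u k ≡ b → blockStart u (suc k) ≡ blockStart u k + blockLength b
  blockStart-suc k Dk≡b = cong (λ b → blockStart u k + blockLength b) Dk≡b

  inBlock : ∀ q → ∃[ k ] ∃[ r ] Offset (derived u k) r × blockStart u k + r ≡ q
  inBlock zero = 0 , 0 , head , refl
  inBlock (suc q) with inBlock q
  ... | k , _ , tail ten , refl =
    suc k , 0 , head , trans (+-identityʳ _) (trans (blockStart-suc k ten) (+-suc _ 1))
  ... | k , _ , head , refl with derived u k in ten
  ...   | true  = k , 1 , tail ten , +-suc _ 0
  ...   | false = suc k , 0 , head , trans (+-identityʳ _) (trans (blockStart-suc k ten) (+-suc _ 0))

  1⇒blockStart : ∀ {q} → u q ≡ true → ∃[ k ] blockStart u k ≡ q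
  1⇒blockStart {q} uq≡1 with inBlock q
  ... | k , _ , head , refl = k , sym (+-identityʳ _)
  ... | k , _ , tail ten , refl =
    ⊥-elim (Bool.not-¬ (isTen-tail {u} ten) (trans (cong u (+-comm 1 _)) uq≡1))

  1⇒laterBlockStart : ∀ {q} → u (suc q) ≡ true → ∃[ k ] blockStart u (suc k) ≡ suc q
  1⇒laterBlockStart one with 1⇒blockStart one
  ... | suc k , start≡ = k , start≡

  0⇒blockStart-suc : ∀ {q} → u q ≡ false → ∃[ k ] blockStart u k ≡ suc q
  0⇒blockStart-suc {q} uq≡0 with inBlock q
  ... | k , _ , tail ten , refl = suc k , trans (blockStart-suc k ten) (+-suc _ 1)
  ... | k , _ , head , refl with derived u k in ten
  ...   | true  = ⊥-elim (Bool.not-¬ (isTen-head {u} ten) (trans (sym (cong u (+-identityʳ _))) uq≡0))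
  ...   | false = suc k , trans (blockStart-suc k ten) (+-suc _ 0)

  isTen-agree⇒derivedAgree : ∀ a b n →
    (∀ s → s < n → isTen u (blockStart u a + blocksLength u a s) ≡
                   isTen u (blockStart u b + blocksLength u a s)) →
    blocksLength u b n ≡ blocksLength u a n × Agree (derived u) a b n
  isTen-agree⇒derivedAgree a b zero    _        = refl , λ _ ()
  isTen-agree⇒derivedAgree a b (suc n) sameTen
    with isTen-agree⇒derivedAgree a b n (λ s s<n → sameTen s (m<n⇒m<1+n s<n))
  ... | length≡ , agree =
    cong₂ _+_ length≡ (cong blockLength (sym next)) , Agree-snoc {derived u} {a} {b} agree next
    where
    open ≡-Reasoning
    next : derived u (a + n) ≡ derived u (b + n)
    next = begin
      isTen u (blockStart u (a + n))                ≡⟨ cong (isTen u) (blockStart-+ a n) ⟩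
      isTen u (blockStart u a + blocksLength u a n) ≡⟨ sameTen n ≤-refl ⟩
      isTen u (blockStart u b + blocksLength u a n) ≡⟨ cong (λ l → isTen u (blockStart u b + l)) length≡ ⟨
      isTen u (blockStart u b + blocksLength u b n) ≡⟨ cong (isTen u) (blockStart-+ b n) ⟨
      isTen u (blockStart u (b + n))                ∎

  -- Whether a block-initial 1 starts a block 10 is decided by the letter after it.
  Determines : ℕ → ℕ → ℕ → Set
  Determines a n T = blocksLength u a n ≤ T ×
    (∀ s → s < n → u (blockStart u a + blocksLength u a s) ≡ true → suc (blocksLength u a s) < T)

  Agree⇒derivedAgree : ∀ a b n T → Determines a n T → Agree u (blockStart u a) (blockStart u b) T →
    Agree (derived u) a b n × blockStart u (b + n) ≡ blockStart u b + blocksLength u a n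
  Agree⇒derivedAgree a b n T (covered , lookahead) agree with isTen-agree⇒derivedAgree a b n sameTen
    where
    sameTen : ∀ s → s < n → isTen u (blockStart u a + blocksLength u a s) ≡
                            isTen u (blockStart u b + blocksLength u a s)
    sameTen s s<n = isTen-cong {u} (agree _ (<-≤-trans (blocksLength-< a s<n) covered)) λ one →
      trans (cong u (sym (+-suc _ _))) (trans (agree _ (lookahead s s<n one)) (cong u (+-suc _ _)))
  ... | length≡ , agreeᴰ = agreeᴰ , trans (blockStart-+ b n) (cong (blockStart u b +_) length≡)

  Agree⇒derivedAgree-endingAt : ∀ a b c n T → Determines a n T →
    Agree u (blockStart u a) (blockStart u b) T →
    blockStart u b + blocksLength u a n ≡ blockStart u (c + n) → Agree (derived u) a c n
  Agree⇒derivedAgree-endingAt a b c n T determines agree end≡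
    with Agree⇒derivedAgree a b n T determines agree
  ... | agreeᴰ , end[b+n]≡ with +-cancelʳ-≡ n b c (blockStart-injective (trans end[b+n]≡ end≡))
  ...   | refl = agreeᴰ

module HeadDetermined (u : Seq)
  (head≡ : ∀ k k' → derived u k ≡ derived u k' → u (blockStart u k) ≡ u (blockStart u k')) where

  open Blocks u

  blockAgree : ∀ {k k'} → derived u k ≡ derived u k' →
               Agree u (blockStart u k) (blockStart u k') (blockLength (derived u k))
  blockAgree {k} {k'} same r r< with offset (derived u k) r<
  ... | head     = trans (cong u (+-identityʳ _)) (trans (head≡ k k' same) (cong u (sym (+-identityʳ _))))
  ... | tail ten = begin
    u (blockStart u k + 1)    ≡⟨ cong u (+-comm _ 1) ⟩
    u (suc (blockStart u k))  ≡⟨ isTen-tail {u} ten ⟩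
    false                     ≡⟨ isTen-tail {u} (trans (sym same) ten) ⟨
    u (suc (blockStart u k')) ≡⟨ cong u (+-comm 1 _) ⟩
    u (blockStart u k' + 1)   ∎
    where open ≡-Reasoning

  derivedAgree⇒Agree : ∀ i j n → Agree (derived u) i j n →
    blocksLength u i n ≡ blocksLength u j n × Agree u (blockStart u i) (blockStart u j) (blocksLength u i n)
  derivedAgree⇒Agree i j zero    _     = refl , λ _ ()
  derivedAgree⇒Agree i j (suc n) agree
    with derivedAgree⇒Agree i j n (Agree-≤ {derived u} {i} {j} (n≤1+n n) agree)
  ... | length≡ , agreeᵤ =
      cong₂ _+_ length≡ (cong blockLength same)
    , Agree-++ {u} (blockStart u i) (blockStart u j) (blocksLength u i n) agreeᵤ
        (subst₂ (λ a b → Agree u a b (blockLength (derived u (i + n))))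
          (blockStart-+ i n) (trans (blockStart-+ j n) (cong (blockStart u j +_) (sym length≡)))
          (blockAgree {i + n} {j + n} same))
    where
    same : derived u (i + n) ≡ derived u (j + n)
    same = agree n ≤-refl

  derivedAgree⇒imageAgree : ∀ x i n → Agree (derived u) x i n →
    Agree u (blockStart u x) (blockStart u i) (blocksLength u i n) ×
    blockStart u x + blocksLength u i n ≡ blockStart u (x + n)
  derivedAgree⇒imageAgree x i n agree with derivedAgree⇒Agree x i n agree
  ... | length≡ , agreeᵤ =
    subst (Agree u _ _) length≡ agreeᵤ ,
    trans (cong (blockStart u x +_) (sym length≡)) (sym (blockStart-+ x n))

  derived-Aperiodic : Aperiodic u → Aperiodic (derived u)
  derived-Aperiodic aperiodic p N 1≤p periodic =
    aperiodic P (blockStart u N) (≤-trans 1≤p (blocksLength-≥ N p)) periodicᵤ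
    where
    P = blocksLength u N p
    shifted : ∀ n → Agree (derived u) (N + p) N n
    shifted n t _ = trans (cong (derived u) (xy∙z≈y∙xz N p t)) (periodic (N + t) (m≤m+n N t))
    periodicᵤ : EventuallyPeriodic u P (blockStart u N)
    periodicᵤ q bN≤q with m≤n⇒∃[o]m+o≡n bN≤q
    ... | t , refl with derivedAgree⇒Agree (N + p) N (suc t) (shifted (suc t))
    ...   | _ , agree = begin
      u (P + (blockStart u N + t))   ≡⟨ cong u (x∙yz≈yx∙z P _ t) ⟩
      u (blockStart u N + P + t)     ≡⟨ cong (λ x → u (x + t)) (blockStart-+ N p) ⟨
      u (blockStart u (N + p) + t)   ≡⟨ agree t (blocksLength-≥ (N + p) (suc t)) ⟩
      u (blockStart u N + t)         ∎
      where open ≡-Reasoning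

HasDouble : Seq → Bool → Set
HasDouble u b = ∃[ q ] u q ≡ b × u (suc q) ≡ b

-- u = 1w1⋯ with |w| = n, and 0w0 occurs at position m
Imbalance : Seq → ℕ → Set
Imbalance u n = u 0 ≡ true × u (suc n) ≡ true ×
  ∃[ m ] u m ≡ false × u (m + suc n) ≡ false × Agree u (suc m) 1 n

isTen-false : ∀ {u p} → isTen u p ≡ false → u p ≡ true → u (suc p) ≡ true
isTen-false {u} {p} eq one with u p | u (suc p)
... | true | true = refl

module NoDoubleZero (u : Seq) (u0≡1 : u 0 ≡ true) (no00 : ¬ HasDouble u false) where

  open Blocks u

  blockHead≡1 : ∀ k → u (blockStart u k) ≡ true
  blockHead≡1 zero    = u0≡1
  blockHead≡1 (suc k) with derived u k in ten
  ... | true  = Bool.¬-not λ next≡0 →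
    no00 (suc (blockStart u k) , isTen-tail {u} ten , trans (cong u (+-comm 2 _)) next≡0)
  ... | false = trans (cong u (+-comm _ 1)) (isTen-false {u} ten (blockHead≡1 k))

  open HeadDetermined u (λ k k' _ → trans (blockHead≡1 k) (sym (blockHead≡1 k'))) public

  -- The extra letter is the 1 starting the next block; the letter after it tells 10 from 1.
  imageRightSpecial : ∀ i n → RightSpecial (derived u) i n →
                      RightSpecial u (blockStart u i) (suc (blocksLength u i n))
  imageRightSpecial i n (j , k , agreeʲ , endʲ , agreeᵏ , endᵏ) =
    blockStart u k , blockStart u j , image k agreeᵏ , afterTen , image j agreeʲ , afterOne
    where
    image : ∀ x → Agree (derived u) x i n →
            Agree u (blockStart u x) (blockStart u i) (suc (blocksLength u i n))
    image x agree with derivedAgree⇒imageAgree x i n agree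
    ... | agreeᵤ , end≡ = Agree-snoc {u} {blockStart u x} {blockStart u i} agreeᵤ
      (trans (cong u end≡) (trans (blockHead≡1 (x + n))
             (trans (sym (blockHead≡1 (i + n))) (cong u (blockStart-+ i n)))))
    next : ∀ x → Agree (derived u) x i n →
           blockStart u x + suc (blocksLength u i n) ≡ suc (blockStart u (x + n))
    next x agree = trans (+-suc _ _) (cong suc (proj₂ (derivedAgree⇒imageAgree x i n agree)))
    afterTen : u (blockStart u k + suc (blocksLength u i n)) ≡ false
    afterTen = trans (cong u (next k agreeᵏ)) (isTen-tail {u} endᵏ)
    afterOne : u (blockStart u j + suc (blocksLength u i n)) ≡ true
    afterOne = trans (cong u (trans (next j agreeʲ) (+-comm 1 _)))
                     (trans (cong (λ b → u (blockStart u (j + n) + blockLength b)) (sym endʲ))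
                            (blockHead≡1 (suc (j + n))))

  -- The shorter image agrees with the end of the longer one, which then starts with 1, hence at a block.
  private
    agreeShorter : UniqueRightSpecial u → ∀ n i₁ i₂ →
                   RightSpecial (derived u) i₁ n → RightSpecial (derived u) i₂ n →
                   blocksLength u i₁ n ≤ blocksLength u i₂ n → Agree (derived u) i₁ i₂ n
    agreeShorter unique n i₁ i₂ rs₁ rs₂ S₁≤S₂ with m≤n⇒∃[o]m+o≡n S₁≤S₂
    ... | e , S₁+e≡S₂ = Agree⇒derivedAgree-endingAt i₁ b i₂ n (suc S₁)
                          (n≤1+n S₁ , λ s s<n _ → s≤s (blocksLength-< i₁ s<n)) agreeᵇ end≡
      where
      S₁ = blocksLength u i₁ n
      length≡ : suc (blocksLength u i₂ n) ≡ e + suc S₁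
      length≡ = trans (cong suc (trans (sym S₁+e≡S₂) (+-comm S₁ e))) (sym (+-suc e S₁))
      agreeᵤ : Agree u (blockStart u i₁) (blockStart u i₂ + e) (suc S₁)
      agreeᵤ = unique (suc S₁) _ _ (imageRightSpecial i₁ n rs₁)
        (RightSpecial-suffix {u} (blockStart u i₂) e (suc S₁)
          (subst (RightSpecial u _) length≡ (imageRightSpecial i₂ n rs₂)))
      start : ∃[ b ] blockStart u b ≡ blockStart u i₂ + e
      start = 1⇒blockStart (trans (sym (Agree-head {u} _ _ agreeᵤ)) (blockHead≡1 i₁))
      b = proj₁ start
      agreeᵇ : Agree u (blockStart u i₁) (blockStart u b) (suc S₁)
      agreeᵇ = subst (λ p → Agree u (blockStart u i₁) p (suc S₁)) (sym (proj₂ start)) agreeᵤ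
      end≡ : blockStart u b + S₁ ≡ blockStart u (i₂ + n)
      end≡ = begin
        blockStart u b + S₁                   ≡⟨ cong (_+ S₁) (proj₂ start) ⟩
        blockStart u i₂ + e + S₁              ≡⟨ +-assoc _ e S₁ ⟩
        blockStart u i₂ + (e + S₁)            ≡⟨ cong (blockStart u i₂ +_) (trans (+-comm e S₁) S₁+e≡S₂) ⟩
        blockStart u i₂ + blocksLength u i₂ n ≡⟨ blockStart-+ i₂ n ⟨
        blockStart u (i₂ + n)                 ∎
        where open ≡-Reasoning

  derived-UniqueRightSpecial : UniqueRightSpecial u → UniqueRightSpecial (derived u)
  derived-UniqueRightSpecial unique n i₁ i₂ rs₁ rs₂
    with ≤-total (blocksLength u i₁ n) (blocksLength u i₂ n)
  ... | inj₁ S₁≤S₂ = agreeShorter unique n i₁ i₂ rs₁ rs₂ S₁≤S₂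
  ... | inj₂ S₂≤S₁ =
    Agree-sym {derived u} {i₂} {i₁} (agreeShorter unique n i₂ i₁ rs₂ rs₁ S₂≤S₁)

  -- Read in blocks, the prefix 1w1 is 1 w′ 1 and the factor 0w0 lies in 10 w′ 10.
  complDerived-Imbalance : ∀ N → Imbalance u N → ∃[ n' ] n' < N × Imbalance (compl (derived u)) n'
  complDerived-Imbalance zero (_ , _ , m , um≡0 , um+1≡0 , _) =
    ⊥-elim (no00 (m , um≡0 , trans (cong u (+-comm 1 m)) um+1≡0))
  complDerived-Imbalance (suc n) (_ , _ , zero , u0≡0 , _) = ⊥-elim (Bool.not-¬ u0≡1 u0≡0)
  complDerived-Imbalance (suc n) (_ , uN+1≡1 , suc m' , um≡0 , umN+1≡0 , agree) =
    n' , n'<N , cong not D0≡0 , cong not DK≡0 , M , cong not DM≡1 , cong not D[M+K]≡1 ,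
    Agree-compl {derived u} (suc M) 1 (Agree-sym {derived u} {1} {suc M} (proj₁ aligned))
    where
    N = suc n
    m = suc m'
    u[m+N+1]≡0 : u (suc (m + N)) ≡ false
    u[m+N+1]≡0 = trans (cong u (sym (+-suc m N))) umN+1≡0
    u[m+N]≡1 : u (m + N) ≡ true
    u[m+N]≡1 = Bool.¬-not λ u[m+N]≡0 → no00 (m + N , u[m+N]≡0 , u[m+N+1]≡0)
    uN≡1 : u N ≡ true
    uN≡1 = trans (sym (agree n ≤-refl)) (trans (cong u (sym (+-suc m n))) u[m+N]≡1)
    um'≡1 : u m' ≡ true
    um'≡1 = Bool.¬-not λ um'≡0 → no00 (m' , um'≡0 , um≡0)
    u1≡1 : u 1 ≡ true
    u1≡1 = trans (sym (Agree-head {u} (suc m) 1 agree)) (Bool.¬-not λ u[m+1]≡0 → no00 (m , um≡0 , u[m+1]≡0))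
    D0≡0 : derived u 0 ≡ false
    D0≡0 = cong₂ (λ a b → a ∧ not b) u0≡1 u1≡1
    K-start = 1⇒laterBlockStart uN≡1
    n' = proj₁ K-start
    M-start = 1⇒blockStart um'≡1
    M = proj₁ M-start
    n'<N : n' < N
    n'<N = ≤-trans (blockStart-≥ (suc n')) (≤-reflexive (proj₂ K-start))
    DK≡0 : derived u (suc n') ≡ false
    DK≡0 = trans (cong (isTen u) (proj₂ K-start)) (cong₂ (λ a b → a ∧ not b) uN≡1 uN+1≡1)
    DM≡1 : derived u M ≡ true
    DM≡1 = trans (cong (isTen u) (proj₂ M-start)) (cong₂ (λ a b → a ∧ not b) um'≡1 um≡0)
    start[M+1] : blockStart u (suc M) ≡ suc m
    start[M+1] = trans (blockStart-suc M DM≡1) (trans (cong (_+ 2) (proj₂ M-start)) (+-comm m' 2))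
    start1 : blockStart u 1 ≡ 1
    start1 = cong blockLength D0≡0
    length≡n : blocksLength u 1 n' ≡ n
    length≡n = suc-injective (trans (cong (_+ blocksLength u 1 n') (sym start1))
                                    (trans (sym (blockStart-+ 1 n')) (proj₂ K-start)))
    aligned = Agree⇒derivedAgree 1 (suc M) n' N
      (≤-trans (≤-reflexive length≡n) (n≤1+n n) ,
       λ s s<n' _ → s≤s (<-≤-trans (blocksLength-< 1 s<n') (≤-reflexive length≡n)))
      (subst₂ (λ a b → Agree u a b N) (sym start1) (sym start[M+1]) (Agree-sym {u} {suc m} {1} agree))
    D[M+K]≡1 : derived u (M + suc n') ≡ true
    D[M+K]≡1 = begin
      isTen u (blockStart u (M + suc n'))                  ≡⟨ cong (isTen u ∘ blockStart u) (+-suc M n') ⟩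
      isTen u (blockStart u (suc M + n'))                  ≡⟨ cong (isTen u) (proj₂ aligned) ⟩
      isTen u (blockStart u (suc M) + blocksLength u 1 n') ≡⟨ cong₂ (λ a b → isTen u (a + b)) start[M+1] length≡n ⟩
      isTen u (suc (m + n))                                ≡⟨ cong (isTen u) (+-suc m n) ⟨
      isTen u (m + N)                                      ≡⟨ cong₂ (λ a b → a ∧ not b) u[m+N]≡1 u[m+N+1]≡0 ⟩
      true                                                 ∎
      where open ≡-Reasoning

module NoDoubleOne (u : Seq) (u0≡1 : u 0 ≡ true) (no11 : ¬ HasDouble u true) where

  open Blocks u

  blockHead≡derived : ∀ k → u (blockStart u k) ≡ derived u k
  blockHead≡derived k with u (blockStart u k) in head | u (suc (blockStart u k)) in next
  ... | false | _     = refl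
  ... | true  | false = refl
  ... | true  | true  = ⊥-elim (no11 (blockStart u k , head , next))

  open HeadDetermined u (λ k k' same → trans (blockHead≡derived k) (trans same (sym (blockHead≡derived k'))))
    public

  blockEnd≡0 : ∀ k → ∃[ q ] blockStart u (suc k) ≡ suc q × u q ≡ false
  blockEnd≡0 k with derived u k in ten
  ... | true  = suc (blockStart u k) , +-comm _ 2 , isTen-tail {u} ten
  ... | false = blockStart u k , +-comm _ 1 , trans (blockHead≡derived k) ten

  gap : Bool → ℕ
  gap true  = 0
  gap false = 1

  -- The image of a derived factor, prefixed by the 0 ending the previous block when it starts with 0.
  record Image (i n : ℕ) : Set where
    constructor image
    field
      start    : ℕ
      anchored : start + gap (u start) ≡ blockStart u i
      special  : RightSpecial u start (gap (u start) + blocksLength u i n)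

  derived0≡1 : derived u 0 ≡ true
  derived0≡1 = trans (sym (blockHead≡derived 0)) u0≡1

  precedingZero : ∀ x → derived u x ≡ false → ∃[ q ] suc q ≡ blockStart u x × u q ≡ false
  precedingZero zero    D0≡0 = ⊥-elim (Bool.not-¬ derived0≡1 D0≡0)
  precedingZero (suc x) _    with blockEnd≡0 x
  ... | q , start≡ , uq≡0 = q , sym start≡ , uq≡0

  endLetter : ∀ x i n → Agree (derived u) x i n →
              u (blockStart u x + blocksLength u i n) ≡ derived u (x + n)
  endLetter x i n agree =
    trans (cong u (proj₂ (derivedAgree⇒imageAgree x i n agree))) (blockHead≡derived (x + n))

  rightSpecialImage : ∀ i n → RightSpecial (derived u) i n →
                      RightSpecial u (blockStart u i) (blocksLength u i n)
  rightSpecialImage i n (j , k , agreeʲ , endʲ , agreeᵏ , endᵏ) =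
    blockStart u j , blockStart u k ,
    proj₁ (derivedAgree⇒imageAgree j i n agreeʲ) , trans (endLetter j i n agreeʲ) endʲ ,
    proj₁ (derivedAgree⇒imageAgree k i n agreeᵏ) , trans (endLetter k i n agreeᵏ) endᵏ

  prefixedRightSpecialImage : ∀ i n → RightSpecial (derived u) i (suc n) → derived u i ≡ false →
    ∃[ q ] suc q ≡ blockStart u i × u q ≡ false × RightSpecial u q (suc (blocksLength u i (suc n)))
  prefixedRightSpecialImage i n (j , k , agreeʲ , endʲ , agreeᵏ , endᵏ) Di≡0 with precedingZero i Di≡0
  ... | q , suc≡ , uq≡0 with prefixed j agreeʲ | prefixed k agreeᵏ
    where
    S = blocksLength u i (suc n)
    prefixed : ∀ x → Agree (derived u) x i (suc n) →
               ∃[ qx ] Agree u qx q (suc S) × u (qx + suc S) ≡ derived u (x + suc n)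
    prefixed x agree with precedingZero x (trans (Agree-head {derived u} x i agree) Di≡0)
    ... | qx , sucx≡ , uqx≡0 =
      qx , Agree-cons {u} (trans uqx≡0 (sym uq≡0))
             (subst₂ (λ a b → Agree u a b S) (sym sucx≡) (sym suc≡)
                     (proj₁ (derivedAgree⇒imageAgree x i (suc n) agree))) ,
      trans (cong u (trans (+-suc qx S) (cong (_+ S) sucx≡))) (endLetter x i (suc n) agree)
  ... | qʲ , agreeʲᵤ , afterʲ | qᵏ , agreeᵏᵤ , afterᵏ =
    q , suc≡ , uq≡0 , (qʲ , qᵏ , agreeʲᵤ , trans afterʲ endʲ , agreeᵏᵤ , trans afterᵏ endᵏ)

  imageOf : ∀ i n → RightSpecial (derived u) i (suc n) → Image i (suc n)
  imageOf i n rs with u (blockStart u i) in head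
  ... | true  = image (blockStart u i) (trans (cong (λ b → blockStart u i + gap b) head) (+-identityʳ _))
                  (subst (λ b → RightSpecial u (blockStart u i) (gap b + blocksLength u i (suc n))) (sym head)
                         (rightSpecialImage i (suc n) rs))
  ... | false with prefixedRightSpecialImage i n rs (trans (sym (blockHead≡derived i)) head)
  ...   | q , suc≡ , uq≡0 , special = image q (trans (cong (λ b → q + gap b) uq≡0) (trans (+-comm q 1) suc≡))
                  (subst (λ b → RightSpecial u q (gap b + blocksLength u i (suc n))) (sym uq≡0) special)

  anchor : ∀ q → ∃[ b ] q + gap (u q) ≡ blockStart u b
  anchor q with u q in uq
  ... | true  = let b , start≡ = 1⇒blockStart uq in b , trans (+-identityʳ q) (sym start≡)
  ... | false = let b , start≡ = 0⇒blockStart-suc uq in b , trans (+-comm q 1) (sym start≡)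

  tenLookahead : ∀ i {s n} → s < n → u (blockStart u i + blocksLength u i s) ≡ true →
                 suc (blocksLength u i s) < blocksLength u i n
  tenLookahead i {s} {n} s<n one = begin
    suc (suc (blocksLength u i s))                       ≡⟨ +-comm 2 _ ⟩
    blocksLength u i s + 2                               ≡⟨ cong ((blocksLength u i s +_) ∘ blockLength) ten ⟩
    blocksLength u i s + blockLength (derived u (i + s)) ≤⟨ blocksLength-mono i s<n ⟩
    blocksLength u i n                                   ∎
    where
    open ≤-Reasoning
    ten : true ≡ derived u (i + s)
    ten = trans (sym one) (trans (cong u (sym (blockStart-+ i s))) (blockHead≡derived (i + s)))

  imageLength : ∀ {i n} → Image i n → ℕ
  imageLength {i} {n} im = gap (u (Image.start im)) + blocksLength u i n

  -- The shorter image agrees with the end of the longer one, which is then anchored at a block too.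
  private
    agreeShorter : UniqueRightSpecial u → ∀ n i₁ i₂ (im₁ : Image i₁ (suc n)) (im₂ : Image i₂ (suc n)) →
                   imageLength im₁ ≤ imageLength im₂ → Agree (derived u) i₁ i₂ (suc n)
    agreeShorter unique n i₁ i₂ (image q₁ anchored₁ rs₁) (image q₂ anchored₂ rs₂) L₁≤L₂
      with m≤n⇒∃[o]m+o≡n L₁≤L₂
    ... | e , L₁+e≡L₂ = Agree⇒derivedAgree-endingAt i₁ b i₂ N S₁
                          (≤-refl , λ s s<N → tenLookahead i₁ s<N) agreeᵇ end≡
      where
      N  = suc n
      S₁ = blocksLength u i₁ N
      g  = gap (u q₁)
      L₁ = g + S₁
      agreeᵤ : Agree u q₁ (q₂ + e) L₁
      agreeᵤ = unique L₁ q₁ (q₂ + e) rs₁ (RightSpecial-suffix {u} q₂ e L₁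
        (subst (RightSpecial u q₂) (trans (sym L₁+e≡L₂) (+-comm L₁ e)) rs₂))
      1≤L₁ : 1 ≤ L₁
      1≤L₁ = ≤-trans (s≤s z≤n) (≤-trans (blocksLength-≥ i₁ N) (m≤n+m S₁ g))
      sameGap : gap (u (q₂ + e)) ≡ g
      sameGap = cong gap (sym (Agree-head {u} q₁ (q₂ + e) (Agree-≤ {u} {q₁} {q₂ + e} 1≤L₁ agreeᵤ)))
      b = proj₁ (anchor (q₂ + e))
      anchoredᵇ : q₂ + e + g ≡ blockStart u b
      anchoredᵇ = trans (cong (q₂ + e +_) (sym sameGap)) (proj₂ (anchor (q₂ + e)))
      agreeᵇ : Agree u (blockStart u i₁) (blockStart u b) S₁
      agreeᵇ = subst₂ (λ x y → Agree u x y S₁) anchored₁ anchoredᵇ (Agree-drop {u} q₁ (q₂ + e) g agreeᵤ)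
      end≡ : blockStart u b + S₁ ≡ blockStart u (i₂ + N)
      end≡ = begin
        blockStart u b + S₁                                ≡⟨ cong (_+ S₁) anchoredᵇ ⟨
        q₂ + e + g + S₁                                    ≡⟨ +-assoc (q₂ + e) g S₁ ⟩
        q₂ + e + L₁                                        ≡⟨ +-assoc q₂ e L₁ ⟩
        q₂ + (e + L₁)                                      ≡⟨ cong (q₂ +_) (trans (+-comm e L₁) L₁+e≡L₂) ⟩
        q₂ + (gap (u q₂) + blocksLength u i₂ N)            ≡⟨ +-assoc q₂ _ _ ⟨
        q₂ + gap (u q₂) + blocksLength u i₂ N              ≡⟨ cong (_+ blocksLength u i₂ N) anchored₂ ⟩
        blockStart u i₂ + blocksLength u i₂ N              ≡⟨ blockStart-+ i₂ N ⟨
        blockStart u (i₂ + N)                              ∎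
        where open ≡-Reasoning

  derived-UniqueRightSpecial : UniqueRightSpecial u → UniqueRightSpecial (derived u)
  derived-UniqueRightSpecial unique zero    i₁ i₂ _   _   = λ _ ()
  derived-UniqueRightSpecial unique (suc n) i₁ i₂ rs₁ rs₂
    with imageOf i₁ n rs₁ | imageOf i₂ n rs₂
  ... | im₁ | im₂ with ≤-total (imageLength im₁) (imageLength im₂)
  ...   | inj₁ L₁≤L₂ = agreeShorter unique n i₁ i₂ im₁ im₂ L₁≤L₂
  ...   | inj₂ L₂≤L₁ =
    Agree-sym {derived u} {i₂} {i₁} (agreeShorter unique n i₂ i₁ im₂ im₁ L₂≤L₁)

  -- Read in blocks, the prefix 1w1 is 10 w′ 10 and the factor 0w0 ends with 0 w′ 0.
  derived-Imbalance : ∀ N → Imbalance u N → ∃[ n' ] n' < N × Imbalance (derived u) n'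
  derived-Imbalance zero    (_ , u1≡1 , _) = ⊥-elim (no11 (0 , u0≡1 , u1≡1))
  derived-Imbalance (suc n) (_ , uN+1≡1 , m , um≡0 , umN+1≡0 , agree) =
    n' , s≤s n'≤n , derived0≡1 , DK≡1 , M , DM≡0 , D[M+K]≡0 ,
    Agree-sym {derived u} {1} {suc M} (proj₁ aligned)
    where
    N = suc n
    u1≡0 : u 1 ≡ false
    u1≡0 = Bool.¬-not λ u1≡1 → no11 (0 , u0≡1 , u1≡1)
    start1 : blockStart u 1 ≡ 2
    start1 = cong₂ (λ a b → blockLength (a ∧ not b)) u0≡1 u1≡0
    K-start = 1⇒laterBlockStart uN+1≡1
    n' = proj₁ K-start
    M-start = 0⇒blockStart-suc um≡0
    M = proj₁ M-start
    DM≡0 : derived u M ≡ false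
    DM≡0 = trans (sym (blockHead≡derived M))
                 (trans (cong u (proj₂ M-start)) (trans (Agree-head {u} (suc m) 1 agree) u1≡0))
    start[M+1] : blockStart u (suc M) ≡ suc (suc m)
    start[M+1] = trans (blockStart-suc M DM≡0) (trans (cong (_+ 1) (proj₂ M-start)) (+-comm (suc m) 1))
    length≡n : blocksLength u 1 n' ≡ n
    length≡n = suc-injective (suc-injective
      (trans (cong (_+ blocksLength u 1 n') (sym start1)) (trans (sym (blockStart-+ 1 n')) (proj₂ K-start))))
    n'≤n : n' ≤ n
    n'≤n = ≤-trans (blocksLength-≥ 1 n') (≤-reflexive length≡n)
    DK≡1 : derived u (suc n') ≡ true
    DK≡1 = trans (sym (blockHead≡derived (suc n'))) (trans (cong u (proj₂ K-start)) uN+1≡1)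
    aligned = Agree⇒derivedAgree 1 (suc M) n' n
      (≤-reflexive length≡n , λ s s<n' one → <-≤-trans (tenLookahead 1 s<n' one) (≤-reflexive length≡n))
      (subst₂ (λ a b → Agree u a b n) (sym start1) (trans (+-comm (suc m) 1) (sym start[M+1]))
        (Agree-sym {u} {suc m + 1} {2} (Agree-drop {u} (suc m) 1 1 agree)))
    D[M+K]≡0 : derived u (M + suc n') ≡ false
    D[M+K]≡0 = begin
      derived u (M + suc n')                           ≡⟨ cong (derived u) (+-suc M n') ⟩
      derived u (suc M + n')                           ≡⟨ blockHead≡derived (suc M + n') ⟨
      u (blockStart u (suc M + n'))                    ≡⟨ cong u (proj₂ aligned) ⟩
      u (blockStart u (suc M) + blocksLength u 1 n')   ≡⟨ cong₂ (λ a b → u (a + b)) start[M+1] length≡n ⟩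
      u (suc (suc m) + n)                              ≡⟨ cong u (trans (+-suc m N) (cong suc (+-suc m n))) ⟨
      u (m + suc N)                                    ≡⟨ umN+1≡0 ⟩
      false                                            ∎
      where open ≡-Reasoning

-- Balance

compl-Aperiodic : ∀ {u} → Aperiodic u → Aperiodic (compl u)
compl-Aperiodic aperiodic p N 1≤p periodic =
  aperiodic p N 1≤p λ i N≤i → Bool.not-injective (periodic i N≤i)

compl-UniqueRightSpecial : ∀ {u} → UniqueRightSpecial u → UniqueRightSpecial (compl u)
compl-UniqueRightSpecial {u} unique n i i' rs rs' =
  Agree-compl {u} i i' (unique n i i' (uncompl rs) (uncompl rs'))
  where
  uncompl : ∀ {i} → RightSpecial (compl u) i n → RightSpecial u i n
  uncompl (j , k , agreeʲ , endʲ , agreeᵏ , endᵏ) =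
    k , j , (λ t t<n → Bool.not-injective (agreeᵏ t t<n)) , Bool.not-injective endᵏ ,
            (λ t t<n → Bool.not-injective (agreeʲ t t<n)) , Bool.not-injective endʲ

transitionAfter : ∀ {u q b} → Aperiodic u → u q ≡ b → ¬ ¬ (∃[ i ] u i ≡ b × u (suc i) ≡ not b)
transitionAfter {u} {q} {b} aperiodic uq≡b noTransition = aperiodic 1 q ≤-refl periodic
  where
  constant : ∀ d → u (q + d) ≡ b
  constant zero    = trans (cong u (+-identityʳ q)) uq≡b
  constant (suc d) with u (q + suc d) Bool.≟ b
  ... | yes next≡b = next≡b
  ... | no  next≢b = ⊥-elim (noTransition
    (q + d , constant d , trans (cong u (sym (+-suc q d))) (Bool.¬-not next≢b)))
  periodic : EventuallyPeriodic u 1 q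
  periodic i q≤i with m≤n⇒∃[o]m+o≡n q≤i
  ... | d , refl = trans (cong u (sym (+-suc q d))) (trans (constant (suc d)) (sym (constant d)))

-- With 00, 11 and both transitions present, the factors 0 and 1 would both be right special.
double0⇒¬double1 : ∀ {u} → Aperiodic u → UniqueRightSpecial u → HasDouble u false → ¬ HasDouble u true
double0⇒¬double1 {u} aperiodic unique (q , uq≡0 , uq+1≡0) (p , up≡1 , up+1≡1) =
  transitionAfter aperiodic uq≡0 λ (i , ui≡0 , ui+1≡1) →
  transitionAfter aperiodic up≡1 λ (i' , ui'≡1 , ui'+1≡0) →
  Bool.not-¬ uq≡0 (trans (Agree-head {u} q p (unique 1 q p
    (q  , i , single q q refl                    , after q uq+1≡0 ,
              single i q (trans ui≡0 (sym uq≡0))  , after i ui+1≡1)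
    (i' , p , single i' p (trans ui'≡1 (sym up≡1)) , after i' ui'+1≡0 ,
              single p p refl                     , after p up+1≡1)))
    up≡1)
  where
  single : ∀ a b → u a ≡ u b → Agree u a b 1
  single a b eq = Agree-cons {u} {a} {b} eq λ _ ()
  after : ∀ {b} x → u (suc x) ≡ b → u (x + 1) ≡ b
  after x eq = trans (cong u (+-comm x 1)) eq

noImbalance : ∀ n {u} → Aperiodic u → UniqueRightSpecial u → ¬ Imbalance u n
noImbalance = <-rec (λ n → ∀ {u} → Aperiodic u → UniqueRightSpecial u → ¬ Imbalance u n) step
  where
  step : ∀ n → (∀ {n'} → n' < n → ∀ {u} → Aperiodic u → UniqueRightSpecial u → ¬ Imbalance u n') →
         ∀ {u} → Aperiodic u → UniqueRightSpecial u → ¬ Imbalance u n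
  step n rec {u} aperiodic unique imbalance = ¬¬-excluded-middle {A = HasDouble u false} λ where
    (yes has00) →
      let open NoDoubleOne u (proj₁ imbalance) (double0⇒¬double1 aperiodic unique has00)
          n' , n'<n , imbalance′ = derived-Imbalance n imbalance
      in rec n'<n (derived-Aperiodic aperiodic) (derived-UniqueRightSpecial unique) imbalance′
    (no no00) →
      let open NoDoubleZero u (proj₁ imbalance) no00
          n' , n'<n , imbalance′ = complDerived-Imbalance n imbalance
      in rec n'<n (compl-Aperiodic {derived u} (derived-Aperiodic aperiodic))
                  (compl-UniqueRightSpecial {derived u} (derived-UniqueRightSpecial unique)) imbalance′

-- The set Γ

≤lex-head : ∀ {a b} → a ≤lex b → a 0 ≡ true → b 0 ≡ true
≤lex-head (inj₁ same)                   a0≡1 = trans (sym (same 0)) a0≡1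
≤lex-head (inj₂ (zero  , _ , _ , b0≡1)) _    = b0≡1
≤lex-head (inj₂ (suc _ , prefix , _))   a0≡1 = trans (sym (prefix 0 (s≤s z≤n))) a0≡1

≤lex-second : ∀ {a b} → a ≤lex b → a 0 ≡ b 0 → a 1 ≡ true → b 1 ≡ true
≤lex-second (inj₁ same)                       _     a1≡1 = trans (sym (same 1)) a1≡1
≤lex-second (inj₂ (zero , _ , a0≡0 , b0≡1))   a0≡b0 _    = ⊥-elim (Bool.not-¬ a0≡0 (trans a0≡b0 b0≡1))
≤lex-second (inj₂ (suc zero , _ , _ , b1≡1))  _     _    = b1≡1
≤lex-second (inj₂ (suc (suc _) , prefix , _)) _     a1≡1 = trans (sym (prefix 1 (s≤s (s≤s z≤n)))) a1≡1

≤lex-cong : ∀ {a a′ b b′} → (∀ n → a n ≡ a′ n) → (∀ n → b n ≡ b′ n) → a ≤lex b → a′ ≤lex b′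
≤lex-cong a≡ b≡ (inj₁ same) = inj₁ λ n → trans (sym (a≡ n)) (trans (same n) (b≡ n))
≤lex-cong a≡ b≡ (inj₂ (n , prefix , an≡0 , bn≡1)) =
  inj₂ (n , (λ i i<n → trans (sym (a≡ i)) (trans (prefix i i<n) (b≡ i))) ,
        trans (sym (a≡ n)) an≡0 , trans (sym (b≡ n)) bn≡1)

CharacteristicTail : Seq → Set
CharacteristicTail u = ∃[ v ] CharacteristicSturmian v × v 0 ≡ true × (∀ n → u n ≡ (true ∷ₛ v) n)

module InΓ {u : Seq} (sturmian : Sturmian u) (γ : Γ u) where

  aperiodic : Aperiodic u
  aperiodic = Sturmian⇒Aperiodic {u} sturmian

  u0≡1 : u 0 ≡ true
  u0≡1 = Bool.¬-not λ u0≡0 → Bool.not-¬ u0≡0 (≤lex-head (proj₁ (γ 0)) (cong not u0≡0))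

  -- If u began with 10, Γ would forbid both 00 and 11, making u periodic.
  u1≡1 : u 1 ≡ true
  u1≡1 = Bool.¬-not λ u1≡0 → aperiodic 2 0 (s≤s z≤n) λ i _ →
    trans (alternate u1≡0 (suc i)) (trans (cong not (alternate u1≡0 i)) (Bool.not-involutive (u i)))
    where
    u[k+0] : ∀ k → u (k + 0) ≡ u k
    u[k+0] k = cong u (+-identityʳ k)
    alternate : u 1 ≡ false → ∀ k → u (suc k) ≡ not (u k)
    alternate u1≡0 k with u k in uk
    ... | true  = Bool.¬-not λ next≡1 → Bool.not-¬ u1≡0
      (≤lex-second (proj₂ (γ k)) (trans (u[k+0] k) (trans uk (sym u0≡1)))
                   (trans (cong u (+-comm k 1)) next≡1))
    ... | false = trans (cong u (+-comm 1 k))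
      (≤lex-second (proj₁ (γ k)) (trans (cong not u0≡1) (sym (trans (u[k+0] k) uk))) (cong not u1≡0))

  v : Seq
  v = S^ 1 u

  u≡1v : ∀ n → u n ≡ (true ∷ₛ v) n
  u≡1v zero    = u0≡1
  u≡1v (suc n) = refl

  v-nonperiodic : ¬ Periodic v
  v-nonperiodic (p , 1≤p , periodic) = aperiodic p 1 1≤p λ where
    (suc i) _ → trans (cong u (+-suc p i)) (periodic i)

  below1v : ∀ k → S^ k v ≤lex (true ∷ₛ v)
  below1v k = ≤lex-cong (λ _ → refl) u≡1v (proj₂ (γ (suc k)))

  -- A first mismatch 1 against 0 would give the prefix 1w1 of u and the factor 0w0 at k + 1.
  above0v : ∀ k → (false ∷ₛ v) ≤lex S^ k v
  above0v k with u (suc k) in next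
  ... | true  = inj₂ (0 , (λ _ ()) , refl , trans (cong u (cong suc (+-identityʳ k))) next)
  ... | false with suffixesDiverge {u} sturmian 1 (suc k) (s≤s z≤n)
  ...   | B , diverge with agreeOrMismatch {u} 1 (suc (suc k)) B
  ...     | inj₁ agree = ⊥-elim (diverge agree)
  ...     | inj₂ (d , agree , mismatch) with u (suc d) in ud | u (suc (suc k + d)) in ukd
  ...       | false | true  = inj₂ (suc d , prefix , ud , trans (cong u (cong suc (+-suc k d))) ukd)
    where
    prefix : ∀ i → i < suc d → (false ∷ₛ v) i ≡ S^ k v i
    prefix zero    _         = sym (trans (cong u (cong suc (+-identityʳ k))) next)
    prefix (suc i) (s≤s i<d) = trans (agree i i<d) (cong u (cong suc (sym (+-suc k i))))
  ...       | true  | false = ⊥-elim (noImbalance d aperiodic (Sturmian⇒UniqueRightSpecial {u} sturmian)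
                                (u0≡1 , ud , suc k , next , trans (cong u (cong suc (+-suc k d))) ukd ,
                                 Agree-sym {u} {1} {suc (suc k)} agree))
  ...       | true  | true  = ⊥-elim (mismatch refl)
  ...       | false | false = ⊥-elim (mismatch refl)

  characteristicTail : CharacteristicTail u
  characteristicTail = v , (v-nonperiodic , λ k → above0v k , below1v k) , u1≡1 , u≡1v

characteristicTail⇒Γ : ∀ {u} → CharacteristicTail u → Γ u
characteristicTail⇒Γ {u} (v , (_ , bounds) , v0≡1 , u≡1v) = λ where
    zero    → inj₂ (0 , (λ _ ()) , cong not (u≡1v 0) , u≡1v 0) , inj₁ λ _ → refl
    (suc k) → aboveCompl k ,
              ≤lex-cong (λ n → sym (u≡1v (suc (k + n)))) (λ n → sym (u≡1v n)) (proj₂ (bounds k))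
  where
  aboveCompl : ∀ k → compl u ≤lex S^ (suc k) u
  aboveCompl k with v (k + 0) in vk
  ... | true  = inj₂ (0 , (λ _ ()) , cong not (u≡1v 0) , trans (u≡1v (suc (k + 0))) vk)
  ... | false = inj₂ (1 , prefix , cong not (trans (u≡1v 1) v0≡1) ,
                      trans (u≡1v (suc (k + 1))) (≤lex-second (proj₁ (bounds k)) (sym vk) v0≡1))
    where
    prefix : ∀ i → i < 1 → compl u i ≡ S^ (suc k) u i
    prefix zero    _           = trans (cong not (u≡1v 0)) (sym (trans (u≡1v (suc (k + 0))) vk))
    prefix (suc _) (s≤s ())

proposition2 : (u : Seq) → Sturmian u →
    Γ u ⇔ (∃[ v ] (CharacteristicSturmian v × v 0 ≡ true × (∀ n → u n ≡ (true ∷ₛ v) n)))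
proposition2 u sturmian = mk⇔ (InΓ.characteristicTail {u} sturmian) characteristicTail⇒Γ
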